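{- Let $t$ be a $\lambda$-term. If $t$ is strongly normalizing for the $\beta$-reduction, then $t$ is strongly normalizing for the reduction generated by the union of the four rules $\beta$, $\delta$, $\gamma$ and $assoc$.
   Context: $\lambda$-terms are given by the grammar $\mathcal M ::= x \mid \lambda x.\mathcal M \mid (\mathcal M\ \mathcal M)$; application associates to the left, so $(M\ N\ P)$ means $((M\ N)\ P)$, and $(\lambda x.M\ N)$ denotes the application of the abstraction $\lambda x.M$ to $N$. Terms are taken up to renaming of bound variables (Barendregt's convention). The reduction rules, applicable to any subterm, are: $\beta$: $(\lambda x.M\ N) \triangleright M[x:=N]$ (capture-avoiding substitution); $\delta$: $(\lambda y.\lambda x.M\ N) \triangleright \lambda x.(\lambda y.M\ N)$, where $x$ is not free in $N$; $\gamma$: $(\lambda x.M\ N\ P) \triangleright (\lambda x.(M\ P)\ N)$, where $x$ is not free in $P$; $assoc$: $(M\ (\lambda x.N\ P)) \triangleright (\lambda x.(M\ N)\ P)$, where $x$ is not free in $M$. A term is strongly normalizing for a given reduction if every reduction sequence starting from it is finite. -}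

module Defs where

open import Data.Nat using (ℕ; zero; suc)
open import Induction.WellFounded using (Acc)

data Term : Set where
  var : ℕ → Term
  lam : Term → Term
  app : Term → Term → Term

Ren : Set
Ren = ℕ → ℕ

liftR : Ren → Ren
liftR ρ zero    = zero
liftR ρ (suc n) = suc (ρ n)

rename : Ren → Term → Term
rename ρ (var n)   = var (ρ n)
rename ρ (lam t)   = lam (rename (liftR ρ) t)
rename ρ (app t u) = app (rename ρ t) (rename ρ u)

shift : Term → Term
shift = rename suc

swap01 : Ren
swap01 zero          = suc zero
swap01 (suc zero)    = zero
swap01 (suc (suc n)) = suc (suc n)

Sub : Set
Sub = ℕ → Term

liftS : Sub → Sub
liftS σ zero    = var zero
liftS σ (suc n) = shift (σ n)

subst : Sub → Term → Term
subst σ (var n)   = σ n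
subst σ (lam t)   = lam (subst (liftS σ) t)
subst σ (app t u) = app (subst σ t) (subst σ u)

single : Term → Sub
single N zero    = N
single N (suc n) = var n

_[0:=_] : Term → Term → Term
M [0:= N ] = subst (single N) M

data _→β_ : Term → Term → Set where
  β     : ∀ {M N} → app (lam M) N →β (M [0:= N ])
  ξlam  : ∀ {M M'} → M →β M' → lam M →β lam M'
  ξappl : ∀ {M M' N} → M →β M' → app M N →β app M' N
  ξappr : ∀ {M N N'} → N →β N' → app M N →β app M N'

-- one-step reduction for β ∪ δ ∪ γ ∪ assoc (compatible closure)
-- δ     : (λy.λx.M  N)      ▷ λx.(λy.M  N)        (x ∉ FV N)
-- γ     : (λx.M  N  P)      ▷ (λx.(M P)  N)       (x ∉ FV P)
-- assoc : (M  (λx.N  P))    ▷ (λx.(M N)  P)       (x ∉ FV M)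
-- In de Bruijn form the freshness side conditions are realised by shifting.
data _→βδγa_ : Term → Term → Set where
  β     : ∀ {M N} → app (lam M) N →βδγa (M [0:= N ])
  δ     : ∀ {M N} →
          app (lam (lam M)) N →βδγa lam (app (lam (rename swap01 M)) (shift N))
  γ     : ∀ {M N P} → app (app (lam M) N) P →βδγa app (lam (app M (shift P))) N
  assoc : ∀ {M N P} → app M (app (lam N) P) →βδγa app (lam (app (shift M) N)) P
  ξlam  : ∀ {M M'} → M →βδγa M' → lam M →βδγa lam M'
  ξappl : ∀ {M M' N} → M →βδγa M' → app M N →βδγa app M' N
  ξappr : ∀ {M N N'} → N →βδγa N' → app M N →βδγa app M N'

-- strong normalisation w.r.t. a one-step reduction R:
-- accessibility for the converse relation (every reduction sequence is finite)
SN : (Term → Term → Set) → Term → Set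
SN R t = Acc (λ u v → R v u) t

module Submission where

-- Mark some β-redexes (λ.M) N of a term as lets, giving an annotated
-- term.  Its contractum is obtained by contracting every marked redex; its
-- arguments are the arguments N of the marked redexes, expressed in the
-- scope of the whole term.  A step of the annotated term either reduces the
-- contractum (a step in an unmarked part, or a redex that becomes marked),
-- or replaces one argument by smaller ones (contracting a marked redex, a
-- step inside an argument, assoc splitting an argument), or merely moves a
-- let (δ, γ), which decreases a numerical weight of the annotation.  So the
-- measure (multiset of contractum and arguments, weight) decreases
-- lexicographically, the multisets being compared by the Dershowitz–Manna
-- ordering over "reduct or subterm"; this is well-founded when contractum
-- and arguments are strongly normalising (sn-reading).  The theorem follows
-- by induction on β-strong normalisation and subterms: a term is an
-- abstraction, a variable applied to arguments (sn-var-spine; an assoc-step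
-- in the spine creates a redex handled by sn-expand), or a redex applied to
-- arguments, whose contractum is a β-reduct (sn-expand).

open import Defs

open import Data.Empty using (⊥-elim)
open import Data.Nat using (ℕ; zero; suc; _*_; _<_; s≤s)
open import Data.Nat.Induction using (<-wellFounded)
open import Data.Nat.Properties using (*-monoʳ-<; *-suc; ≤-reflexive; ≤-trans; n≤1+n)
open import Data.Product using (Σ; _×_; _,_; proj₁; proj₂)
open import Data.Sum using (_⊎_; inj₁; inj₂)
open import Data.Unit using (⊤; tt)
open import Data.List using (List; []; _∷_; _++_)
open import Data.List.Membership.Propositional.Properties using (∈-∃++)
open import Data.List.Relation.Binary.Permutation.Propositional
  using (_↭_; ↭-sym; ↭-trans; ↭-refl; ↭-reflexive; prep; swap)
open import Data.List.Relation.Binary.Permutation.Propositional.Properties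
  using (drop-∷; drop-mid; ∈-resp-↭; ++⁺ˡ; ¬x∷xs↭[]) renaming (shift to ↭-shift)
open import Data.List.Relation.Binary.Pointwise as Pointwise using (Pointwise; []; _∷_)
open import Data.List.Relation.Unary.All as All using (All; []; _∷_)
open import Data.List.Relation.Unary.All.Properties using (++⁻ʳ)
open import Data.List.Relation.Unary.Any using (here; there)
open import Function using (_∘_; id)
open import Induction.WellFounded using (Acc; acc)
open import Relation.Binary.Construct.Closure.ReflexiveTransitive as Star
  using (Star; _◅_; _◅◅_; gmap)
open import Relation.Binary.Construct.Closure.Transitive as Plus
  using (TransClosure; [_]; _∷_; _∷ʳ_)
import Relation.Binary.PropositionalEquality as ≡
open import Relation.Binary.PropositionalEquality
  using (_≡_; refl; sym; trans; cong; cong₂; module ≡-Reasoning)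
open ≡-Reasoning

infix 4 _≐_
_≐_ : {A : Set} → (ℕ → A) → (ℕ → A) → Set
f ≐ g = ∀ i → f i ≡ g i

liftR-ext : ∀ {ρ ρ'} → ρ ≐ ρ' → liftR ρ ≐ liftR ρ'
liftR-ext e zero    = refl
liftR-ext e (suc i) = cong suc (e i)

rename-ext : ∀ {ρ ρ'} → ρ ≐ ρ' → ∀ t → rename ρ t ≡ rename ρ' t
rename-ext e (var x)   = cong var (e x)
rename-ext e (lam t)   = cong lam (rename-ext (liftR-ext e) t)
rename-ext e (app t u) = cong₂ app (rename-ext e t) (rename-ext e u)

liftS-ext : ∀ {σ σ'} → σ ≐ σ' → liftS σ ≐ liftS σ'
liftS-ext e zero    = refl
liftS-ext e (suc i) = cong shift (e i)

subst-ext : ∀ {σ σ'} → σ ≐ σ' → ∀ t → subst σ t ≡ subst σ' t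
subst-ext e (var x)   = e x
subst-ext e (lam t)   = cong lam (subst-ext (liftS-ext e) t)
subst-ext e (app t u) = cong₂ app (subst-ext e t) (subst-ext e u)

rename-rename : ∀ ρ ρ' t → rename ρ (rename ρ' t) ≡ rename (ρ ∘ ρ') t
rename-rename ρ ρ' (var x)   = refl
rename-rename ρ ρ' (lam t)   =
  cong lam (trans (rename-rename (liftR ρ) (liftR ρ') t)
                  (rename-ext (λ { zero → refl ; (suc i) → refl }) t))
rename-rename ρ ρ' (app t u) = cong₂ app (rename-rename ρ ρ' t) (rename-rename ρ ρ' u)

subst-rename : ∀ σ ρ t → subst σ (rename ρ t) ≡ subst (σ ∘ ρ) t
subst-rename σ ρ (var x)   = refl
subst-rename σ ρ (lam t)   =
  cong lam (trans (subst-rename (liftS σ) (liftR ρ) t)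
                  (subst-ext (λ { zero → refl ; (suc i) → refl }) t))
subst-rename σ ρ (app t u) = cong₂ app (subst-rename σ ρ t) (subst-rename σ ρ u)

rename-subst : ∀ ρ σ t → rename ρ (subst σ t) ≡ subst (rename ρ ∘ σ) t
rename-subst ρ σ (var x)   = refl
rename-subst ρ σ (lam t)   =
  cong lam (trans (rename-subst (liftR ρ) (liftS σ) t) (subst-ext lift-comm t))
  where
  lift-comm : rename (liftR ρ) ∘ liftS σ ≐ liftS (rename ρ ∘ σ)
  lift-comm zero    = refl
  lift-comm (suc i) = trans (rename-rename (liftR ρ) suc (σ i)) (sym (rename-rename suc ρ (σ i)))
rename-subst ρ σ (app t u) = cong₂ app (rename-subst ρ σ t) (rename-subst ρ σ u)

subst-subst : ∀ σ σ' t → subst σ (subst σ' t) ≡ subst (subst σ ∘ σ') t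
subst-subst σ σ' (var x)   = refl
subst-subst σ σ' (lam t)   =
  cong lam (trans (subst-subst (liftS σ) (liftS σ') t) (subst-ext lift-comm t))
  where
  lift-comm : subst (liftS σ) ∘ liftS σ' ≐ liftS (subst σ ∘ σ')
  lift-comm zero    = refl
  lift-comm (suc i) = trans (subst-rename (liftS σ) suc (σ' i)) (sym (rename-subst suc σ (σ' i)))
subst-subst σ σ' (app t u) = cong₂ app (subst-subst σ σ' t) (subst-subst σ σ' u)

rename-id : ∀ {ρ} → ρ ≐ (λ i → i) → ∀ t → rename ρ t ≡ t
rename-id e (var x)   = cong var (e x)
rename-id e (lam t)   = cong lam (rename-id (λ { zero → refl ; (suc i) → cong suc (e i) }) t)
rename-id e (app t u) = cong₂ app (rename-id e t) (rename-id e u)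

subst-var : ∀ t → subst var t ≡ t
subst-var (var x)   = refl
subst-var (lam t)   = cong lam (trans (subst-ext (λ { zero → refl ; (suc i) → refl }) t) (subst-var t))
subst-var (app t u) = cong₂ app (subst-var t) (subst-var u)

rename-as-subst : ∀ ρ t → rename ρ t ≡ subst (var ∘ ρ) t
rename-as-subst ρ (var x)   = refl
rename-as-subst ρ (lam t)   =
  cong lam (trans (rename-as-subst (liftR ρ) t) (subst-ext (λ { zero → refl ; (suc i) → refl }) t))
rename-as-subst ρ (app t u) = cong₂ app (rename-as-subst ρ t) (rename-as-subst ρ u)

_⨾_ : Sub → Sub → Sub
(σ ⨾ τ) i = subst τ (σ i)

ext : Sub → Term → Sub
ext σ v zero    = v
ext σ v (suc i) = σ i

ext-ext : ∀ {σ σ' v v'} → σ ≐ σ' → v ≡ v' → ext σ v ≐ ext σ' v'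
ext-ext e refl zero    = refl
ext-ext e refl (suc i) = e i

shift-subst : ∀ σ t → shift (subst σ t) ≡ subst (liftS σ) (shift t)
shift-subst σ t = trans (rename-subst suc σ t) (sym (subst-rename (liftS σ) suc t))

subst-ext-shift : ∀ σ v t → subst (ext σ v) (shift t) ≡ subst σ t
subst-ext-shift σ v t = subst-rename (ext σ v) suc t

subst-single-shift : ∀ v t → (shift t) [0:= v ] ≡ t
subst-single-shift v t = trans (subst-rename (single v) suc t) (subst-var t)

subst-single : ∀ σ M N → subst σ (M [0:= N ]) ≡ (subst (liftS σ) M) [0:= subst σ N ]
subst-single σ M N = begin
  subst σ (M [0:= N ])                                ≡⟨ subst-subst σ (single N) M ⟩
  subst (subst σ ∘ single N) M                        ≡⟨ subst-ext agree M ⟩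
  subst (subst (single (subst σ N)) ∘ liftS σ) M      ≡⟨ subst-subst (single (subst σ N)) (liftS σ) M ⟨
  (subst (liftS σ) M) [0:= subst σ N ]                ∎
  where
  agree : subst σ ∘ single N ≐ subst (single (subst σ N)) ∘ liftS σ
  agree zero    = refl
  agree (suc i) = sym (subst-single-shift (subst σ N) (σ i))

subst-swap : ∀ σ M → subst (liftS (liftS σ)) (rename swap01 M) ≡ rename swap01 (subst (liftS (liftS σ)) M)
subst-swap σ M = begin
  subst (liftS (liftS σ)) (rename swap01 M)          ≡⟨ subst-rename _ swap01 M ⟩
  subst (liftS (liftS σ) ∘ swap01) M                 ≡⟨ subst-ext agree M ⟩
  subst (rename swap01 ∘ liftS (liftS σ)) M          ≡⟨ rename-subst swap01 _ M ⟨
  rename swap01 (subst (liftS (liftS σ)) M)          ∎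
  where
  agree : liftS (liftS σ) ∘ swap01 ≐ rename swap01 ∘ liftS (liftS σ)
  agree zero          = refl
  agree (suc zero)    = refl
  agree (suc (suc i)) = sym (begin
    rename swap01 (shift (shift (σ i)))  ≡⟨ rename-rename swap01 suc (shift (σ i)) ⟩
    rename (swap01 ∘ suc) (shift (σ i))  ≡⟨ rename-rename _ suc (σ i) ⟩
    rename (suc ∘ suc) (σ i)             ≡⟨ rename-rename suc suc (σ i) ⟨
    shift (shift (σ i))                  ∎)

infix 4 _⟶_ _⟶*_ _⟶⁺_
_⟶_ : Term → Term → Set
_⟶_ = _→βδγa_

_⟶*_ : Term → Term → Set
_⟶*_ = Star _⟶_

_⟶⁺_ : Term → Term → Set
t ⟶⁺ v = Σ Term λ u → (t ⟶ u) × (u ⟶* v)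

lam* : ∀ {t u} → t ⟶* u → lam t ⟶* lam u
lam* = gmap lam ξlam

appl* : ∀ {t u} v → t ⟶* u → app t v ⟶* app u v
appl* v = gmap (λ t → app t v) ξappl

app* : ∀ {t t' u u'} → t ⟶* t' → u ⟶* u' → app t u ⟶* app t' u'
app* {t' = t'} {u = u} p q = appl* u p ◅◅ gmap (app t') ξappr q

≡⇒⟶* : ∀ {t u} → t ≡ u → t ⟶* u
≡⇒⟶* refl = Star.ε

⟶-resp-≡ : ∀ {t u u'} → t ⟶ u → u ≡ u' → t ⟶ u'
⟶-resp-≡ s refl = s

subst-step : ∀ σ {t u} → t ⟶ u → subst σ t ⟶ subst σ u
subst-step σ (β {M} {N}) = ⟶-resp-≡ β (sym (subst-single σ M N))
subst-step σ (δ {M} {N}) =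
  ⟶-resp-≡ δ (cong₂ (λ a b → lam (app (lam a) b)) (sym (subst-swap σ M)) (shift-subst σ N))
subst-step σ (γ {M} {N} {P}) =
  ⟶-resp-≡ γ (cong (λ a → app (lam (app (subst (liftS σ) M) a)) (subst σ N)) (shift-subst σ P))
subst-step σ (assoc {M} {N} {P}) =
  ⟶-resp-≡ assoc (cong (λ a → app (lam (app a (subst (liftS σ) N))) (subst σ P)) (shift-subst σ M))
subst-step σ (ξlam s)  = ξlam (subst-step (liftS σ) s)
subst-step σ (ξappl s) = ξappl (subst-step σ s)
subst-step σ (ξappr s) = ξappr (subst-step σ s)

rename-step : ∀ ρ {t u} → t ⟶ u → rename ρ t ⟶ rename ρ u
rename-step ρ {t} {u} s with subst-step (var ∘ ρ) s
... | s' rewrite sym (rename-as-subst ρ t) | sym (rename-as-subst ρ u) = s'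

rename-step* : ∀ ρ {t u} → t ⟶* u → rename ρ t ⟶* rename ρ u
rename-step* ρ = gmap (rename ρ) (rename-step ρ)

liftS-mono : ∀ {σ σ'} → (∀ i → σ i ⟶* σ' i) → ∀ i → liftS σ i ⟶* liftS σ' i
liftS-mono h zero    = Star.ε
liftS-mono h (suc i) = rename-step* suc (h i)

subst-mono : ∀ {σ σ'} → (∀ i → σ i ⟶* σ' i) → ∀ t → subst σ t ⟶* subst σ' t
subst-mono h (var x)   = h x
subst-mono h (lam t)   = lam* (subst-mono (liftS-mono h) t)
subst-mono h (app t u) = app* (subst-mono h t) (subst-mono h u)

rename-single : ∀ ρ M N → rename ρ (M [0:= N ]) ≡ (rename (liftR ρ) M) [0:= rename ρ N ]
rename-single ρ M N = begin
  rename ρ (M [0:= N ])                          ≡⟨ rename-subst ρ (single N) M ⟩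
  subst (rename ρ ∘ single N) M                  ≡⟨ subst-ext agree M ⟩
  subst (single (rename ρ N) ∘ liftR ρ) M        ≡⟨ subst-rename (single (rename ρ N)) (liftR ρ) M ⟨
  (rename (liftR ρ) M) [0:= rename ρ N ]         ∎
  where
  agree : rename ρ ∘ single N ≐ single (rename ρ N) ∘ liftR ρ
  agree zero    = refl
  agree (suc i) = refl

rename-shift : ∀ ρ N → rename (liftR ρ) (shift N) ≡ shift (rename ρ N)
rename-shift ρ N = trans (rename-rename (liftR ρ) suc N) (sym (rename-rename suc ρ N))

rename-swap : ∀ ρ M → rename (liftR (liftR ρ)) (rename swap01 M) ≡ rename swap01 (rename (liftR (liftR ρ)) M)
rename-swap ρ M = trans (rename-rename _ swap01 M) (trans (rename-ext agree M) (sym (rename-rename swap01 _ M)))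
  where
  agree : liftR (liftR ρ) ∘ swap01 ≐ swap01 ∘ liftR (liftR ρ)
  agree zero          = refl
  agree (suc zero)    = refl
  agree (suc (suc i)) = refl

rename-app-inv : ∀ ρ t {a b} → rename ρ t ≡ app a b →
  Σ Term λ t₁ → Σ Term λ t₂ → (t ≡ app t₁ t₂) × (rename ρ t₁ ≡ a) × (rename ρ t₂ ≡ b)
rename-app-inv ρ (app t₁ t₂) refl = t₁ , t₂ , refl , refl , refl

rename-lam-inv : ∀ ρ t {a} → rename ρ t ≡ lam a →
  Σ Term λ t₁ → (t ≡ lam t₁) × (rename (liftR ρ) t₁ ≡ a)
rename-lam-inv ρ (lam t₁) refl = t₁ , refl , refl

-- A step from a renamed term is the renaming of a step: renaming creates
-- no redexes.  (Needed because arguments of marked redexes occur renamed.)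
rename-reflect : ∀ ρ t {u X} → rename ρ t ≡ u → u ⟶ X →
  Σ Term λ t' → (t ⟶ t') × (X ≡ rename ρ t')
rename-reflect ρ t eq β with rename-app-inv ρ t eq
... | t₁ , t₂ , refl , e₁ , refl with rename-lam-inv ρ t₁ e₁
... | M , refl , refl = _ , β , sym (rename-single ρ M t₂)
rename-reflect ρ t eq δ with rename-app-inv ρ t eq
... | t₁ , t₂ , refl , e₁ , refl with rename-lam-inv ρ t₁ e₁
... | t₁' , refl , e₂ with rename-lam-inv (liftR ρ) t₁' e₂
... | M , refl , refl =
  _ , δ , cong₂ (λ a b → lam (app (lam a) b)) (sym (rename-swap ρ M)) (sym (rename-shift ρ t₂))
rename-reflect ρ t eq γ with rename-app-inv ρ t eq
... | t₁ , P , refl , e₁ , refl with rename-app-inv ρ t₁ e₁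
... | s₁ , N , refl , e₂ , refl with rename-lam-inv ρ s₁ e₂
... | M , refl , refl =
  _ , γ , cong (λ a → app (lam (app (rename (liftR ρ) M) a)) (rename ρ N)) (sym (rename-shift ρ P))
rename-reflect ρ t eq assoc with rename-app-inv ρ t eq
... | M , t₂ , refl , refl , e₁ with rename-app-inv ρ t₂ e₁
... | s₁ , P , refl , e₂ , refl with rename-lam-inv ρ s₁ e₂
... | N , refl , refl =
  _ , assoc , cong (λ a → app (lam (app a (rename (liftR ρ) N))) (rename ρ P)) (sym (rename-shift ρ M))
rename-reflect ρ t eq (ξlam s) with rename-lam-inv ρ t eq
... | t₁ , refl , e₁ with rename-reflect (liftR ρ) t₁ e₁ s
... | t₁' , s' , refl = lam t₁' , ξlam s' , refl
rename-reflect ρ t eq (ξappl s) with rename-app-inv ρ t eq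
... | t₁ , t₂ , refl , e₁ , refl with rename-reflect ρ t₁ e₁ s
... | t₁' , s' , refl = app t₁' t₂ , ξappl s' , refl
rename-reflect ρ t eq (ξappr s) with rename-app-inv ρ t eq
... | t₁ , t₂ , refl , refl , e₂ with rename-reflect ρ t₂ e₂ s
... | t₂' , s' , refl = app t₁ t₂' , ξappr s' , refl

data _⊳_ : Term → Term → Set where
  sub-lam : ∀ {t}   → lam t ⊳ t
  sub-l   : ∀ {t u} → app t u ⊳ t
  sub-r   : ∀ {t u} → app t u ⊳ u

data _⊵_ : Term → Term → Set where
  here   : ∀ {t} → t ⊵ t
  deeper : ∀ {t u v} → t ⊵ u → u ⊳ v → t ⊵ v

module SubtermClosure (R : Term → Term → Set)
                      (R-lam : ∀ {t u} → R t u → R (lam t) (lam u))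
                      (R-appl : ∀ {t u v} → R t u → R (app t v) (app u v))
                      (R-appr : ∀ {t u v} → R t u → R (app v t) (app v u)) where

  _≺_ : Term → Term → Set
  b ≺ a = R a b ⊎ a ⊳ b

  _<⁺_ : Term → Term → Set
  _<⁺_ = TransClosure _≺_

  lift-⊳ : ∀ {t s s'} → t ⊳ s → R s s' → Σ Term λ t' → R t t' × (t' ⊳ s')
  lift-⊳ sub-lam r = _ , R-lam r , sub-lam
  lift-⊳ sub-l   r = _ , R-appl r , sub-l
  lift-⊳ sub-r   r = _ , R-appr r , sub-r

  lift-⊵ : ∀ {t s s'} → t ⊵ s → R s s' → Σ Term λ t' → R t t' × (t' ⊵ s')
  lift-⊵ here r = _ , r , here
  lift-⊵ (deeper p q) r with lift-⊳ q r
  ... | u' , r' , q' with lift-⊵ p r'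
  ... | t' , r'' , p' = t' , r'' , deeper p' q'

  sn-⊳ : ∀ {t u} → SN R t → t ⊳ u → SN R u
  sn-⊳ (acc h) q = acc λ r → let (t' , r' , q') = lift-⊳ q r in sn-⊳ (h r') q'

  -- Main induction: on the R-accessibility of t, every s below t is
  -- ≺-accessible; an R-step of s lifts to t, a subterm of s is still below t.
  acc-below : ∀ t → SN R t → ∀ s → t ⊵ s → Acc _≺_ s
  acc-below-step : ∀ t → SN R t → ∀ s → t ⊵ s → ∀ {b} → b ≺ s → Acc _≺_ b
  acc-below t a s p = acc (acc-below-step t a s p)
  acc-below-step t (acc h) s p {b} (inj₁ r) with lift-⊵ p r
  ... | t' , r' , p' = acc-below t' (h r') b p'
  acc-below-step t a (lam s)   p (inj₂ sub-lam) = acc-below t a s (deeper p sub-lam)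
  acc-below-step t a (app s u) p (inj₂ sub-l)   = acc-below t a s (deeper p sub-l)
  acc-below-step t a (app u s) p (inj₂ sub-r)   = acc-below t a s (deeper p sub-r)

  acc-≺ : ∀ {t} → SN R t → Acc _≺_ t
  acc-≺ {t} a = acc-below t a t here

  acc-≺⁺ : ∀ {t} → SN R t → Acc _<⁺_ t
  acc-≺⁺ a = Plus.accessible _≺_ (acc-≺ a)

  <⁺-sub : ∀ {a b} → a ⊳ b → b <⁺ a
  <⁺-sub q = [ inj₂ q ]

module Full = SubtermClosure _⟶_ ξlam ξappl ξappr
module Beta = SubtermClosure _→β_ ξlam ξappl ξappr

open Full using (_<⁺_; <⁺-sub)

-- The Dershowitz–Manna ordering on finite multisets, represented as lists
-- up to permutation, over an arbitrary relation _⊏_: one step replaces an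
-- element by finitely many ⊏-smaller ones.  Its well-foundedness on
-- multisets of ⊏-accessible elements is the classical argument: induction
-- on the accessibility of the head element, then of the tail.
module Multiset {A : Set} (_⊏_ : A → A → Set) where

  DMStep : List A → List A → Set
  DMStep l' l = Σ A λ a → Σ (List A) λ m → Σ (List A) λ bs →
                (l ↭ a ∷ m) × (l' ↭ bs ++ m) × All (_⊏ a) bs

  DM⁺ : List A → List A → Set
  DM⁺ = TransClosure DMStep

  ↭-cons-inv : ∀ {a m x l} → a ∷ m ↭ x ∷ l →
               (a ≡ x × m ↭ l) ⊎ Σ (List A) λ m₀ → (l ↭ a ∷ m₀) × (m ↭ x ∷ m₀)
  ↭-cons-inv {a} {m} {x} {l} p with ∈-resp-↭ p (here refl)
  ... | here refl = inj₁ (refl , drop-∷ p)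
  ... | there a∈l with ∈-∃++ a∈l
  ... | ys , zs , refl = inj₂ (ys ++ zs , ↭-shift a ys zs , drop-mid [] (x ∷ ys) p)

  acc-↭ : ∀ {l l'} → l ↭ l' → Acc DMStep l → Acc DMStep l'
  acc-↭ p (acc h) = acc λ { (a , m , bs , q , r , s) → h (a , m , bs , ↭-trans p q , r , s) }

  acc-[] : Acc DMStep []
  acc-[] = acc λ { (a , m , bs , q , r , s) → ⊥-elim (¬x∷xs↭[] (↭-sym q)) }

  -- A step from
  -- x ∷ l either replaces x itself (then use the accessibility of x on each
  -- replacement) or replaces an element of l (then use that of l).
  acc-∷ : ∀ x → Acc _⊏_ x → ∀ l → Acc DMStep l → Acc DMStep (x ∷ l)
  acc-++ : ∀ x → Acc _⊏_ x → ∀ bs m → All (_⊏ x) bs → Acc DMStep m → Acc DMStep (bs ++ m)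
  acc-∷-step : ∀ x → Acc _⊏_ x → ∀ l → Acc DMStep l →
               ∀ {a m bs l'} → (x ∷ l ↭ a ∷ m) → (l' ↭ bs ++ m) → All (_⊏ a) bs → Acc DMStep l'

  acc-∷ x ax l al = acc λ { (a , m , bs , q , r , s) → acc-∷-step x ax l al q r s }

  acc-++ x (acc hx) []       m []           am = am
  acc-++ x (acc hx) (b ∷ bs) m (b⊏x ∷ s) am = acc-∷ b (hx b⊏x) (bs ++ m) (acc-++ x (acc hx) bs m s am)

  acc-∷-step x ax l (acc hl) {a} {m} {bs} q r s with ↭-cons-inv (↭-sym q)
  ... | inj₁ (refl , m↭l) = acc-↭ (↭-sym r) (acc-++ x ax bs m s (acc-↭ (↭-sym m↭l) (acc hl)))
  ... | inj₂ (m₀ , l↭am₀ , m↭xm₀) =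
        acc-↭ (↭-sym (↭-trans r (↭-trans (++⁺ˡ bs m↭xm₀) (↭-shift x bs m₀))))
              (acc-∷ x ax (bs ++ m₀) (hl (a , m₀ , bs , l↭am₀ , ↭-refl , s)))

  acc-DM : ∀ l → All (Acc _⊏_) l → Acc DMStep l
  acc-DM []      []        = acc-[]
  acc-DM (x ∷ l) (ax ∷ al) = acc-∷ x ax l (acc-DM l al)

  acc-DM⁺ : ∀ l → All (Acc _⊏_) l → Acc DM⁺ l
  acc-DM⁺ l al = Plus.accessible DMStep (acc-DM l al)

  DMStep-∷ : ∀ {x l l'} → DMStep l' l → DMStep (x ∷ l') (x ∷ l)
  DMStep-∷ {x} (a , m , bs , p , q , s) =
    a , x ∷ m , bs , ↭-trans (prep x p) (swap x a ↭-refl) ,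
    ↭-trans (prep x q) (↭-sym (↭-shift x bs m)) , s

  DM⁺-∷ : ∀ {x l l'} → DM⁺ l' l → DM⁺ (x ∷ l') (x ∷ l)
  DM⁺-∷ [ d ]    = [ DMStep-∷ d ]
  DM⁺-∷ (d ∷ ds) = DMStep-∷ d ∷ DM⁺-∷ ds

  DMStep-↭ : ∀ {l l' l''} → l'' ↭ l' → DMStep l' l → DMStep l'' l
  DMStep-↭ r (a , m , bs , p , q , s) = a , m , bs , p , ↭-trans r q , s

  DM⁺-↭ : ∀ {l l' l''} → l'' ↭ l' → DM⁺ l' l → DM⁺ l'' l
  DM⁺-↭ r [ d ]    = [ DMStep-↭ r d ]
  DM⁺-↭ r (d ∷ ds) = DMStep-↭ r d ∷ ds

-- An annotated term is a term some of whose β-redexes are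
-- marked as lets.  The arguments N of lets are kept in the OUTER scope: the
-- free variables of the whole term together with the variables bound by
-- enclosing lets, but not those bound by enclosing abstractions; so the
-- arguments of all lets can be compared with the whole term.  Applications
-- are only allowed outside every abstraction of the annotation (depth
-- outside); below an abstraction (depth inside) there are only lets,
-- abstractions and unannotated terms.
data Depth : Set where
  outside inside : Depth

data Ann : Depth → Set where
  base : ∀ {d} → Term → Ann d
  app  : Ann outside → Term → Ann outside
  let' : ∀ {d} → Term → Ann d → Ann d          -- marked redex (λ.S) N
  lam  : ∀ {d} → Ann inside → Ann d

-- The term an annotation denotes; ρ maps the outer scope into the current one.
⟦_⟧ : ∀ {d} → Ann d → Ren → Term
⟦ base B ⟧   ρ = B
⟦ app S t ⟧  ρ = app (⟦ S ⟧ ρ) t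
⟦ let' N S ⟧ ρ = app (lam (⟦ S ⟧ (liftR ρ))) (rename ρ N)
⟦ lam S ⟧    ρ = lam (⟦ S ⟧ (suc ∘ ρ))

-- The contractum: every let contracted, with τ substituted in the current
-- scope and κ in the outer scope.
contract : ∀ {d} → Ann d → Sub → Sub → Term
contract (base B)   τ κ = subst τ B
contract (app S t)  τ κ = app (contract S τ κ) (subst τ t)
contract (let' N S) τ κ = contract S (ext τ (subst κ N)) (ext κ (subst κ N))
contract (lam S)    τ κ = lam (contract S (liftS τ) (shift ∘ κ))

-- The arguments of the lets, each with the earlier lets contracted and ε
-- substituted in the outer scope.
args : ∀ {d} → Ann d → Sub → List Term
args (base B)   ε = []
args (app S t)  ε = args S ε
args (let' N S) ε = subst ε N ∷ args S (ext ε (subst ε N))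
args (lam S)    ε = args S ε

-- The weight decreases when δ moves a let below an abstraction and when γ
-- moves an application below a let, the two steps that change neither
-- contractum nor arguments.  Leading abstractions of an unannotated term
-- count as abstraction nodes, so that the weight does not depend on
-- whether they are annotated.
baseWeight : Term → ℕ
baseWeight (lam B)   = suc (baseWeight B)
baseWeight (var _)   = 0
baseWeight (app _ _) = 0

weight : ∀ {d} → Ann d → ℕ
weight (base B)   = baseWeight B
weight (app S t)  = 2 * weight S
weight (let' N S) = 2 * suc (weight S)
weight (lam S)    = suc (weight S)

-- Substitution in an annotated term: σc in the current scope, σo in the outer one.
substAnn : ∀ {d} → Sub → Sub → Ann d → Ann d
substAnn σc σo (base B)   = base (subst σc B)
substAnn σc σo (app S t)  = app (substAnn σc σo S) (subst σc t)
substAnn σc σo (let' N S) = let' (subst σo N) (substAnn (liftS σc) (liftS σo) S)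
substAnn σc σo (lam S)    = lam (substAnn (liftS σc) σo S)

-- Annotations without applications are valid at any depth.
embed : ∀ {d} → Ann inside → Ann d
embed (base B)   = base B
embed (let' N S) = let' N (embed S)
embed (lam S)    = lam S

contract-ext : ∀ {d} (S : Ann d) {τ τ' κ κ'} → τ ≐ τ' → κ ≐ κ' →
               contract S τ κ ≡ contract S τ' κ'
contract-ext (base B)   eτ eκ = subst-ext eτ B
contract-ext (app S t)  eτ eκ = cong₂ app (contract-ext S eτ eκ) (subst-ext eτ t)
contract-ext (let' N S) eτ eκ =
  contract-ext S (ext-ext eτ (subst-ext eκ N)) (ext-ext eκ (subst-ext eκ N))
contract-ext (lam S)    eτ eκ = cong lam (contract-ext S (liftS-ext eτ) (λ i → cong shift (eκ i)))

args-ext : ∀ {d} (S : Ann d) {ε ε'} → ε ≐ ε' → args S ε ≡ args S ε'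
args-ext (base B)   e = refl
args-ext (app S t)  e = args-ext S e
args-ext (let' N S) e = cong₂ _∷_ (subst-ext e N) (args-ext S (ext-ext e (subst-ext e N)))
args-ext (lam S)    e = args-ext S e

⟦⟧-substAnn : ∀ {d} (S : Ann d) σc σo ρ ρ' → (∀ i → σc (ρ i) ≡ rename ρ' (σo i)) →
              subst σc (⟦ S ⟧ ρ) ≡ ⟦ substAnn σc σo S ⟧ ρ'
⟦⟧-substAnn (base B)   σc σo ρ ρ' e = refl
⟦⟧-substAnn (app S t)  σc σo ρ ρ' e = cong (λ a → app a (subst σc t)) (⟦⟧-substAnn S σc σo ρ ρ' e)
⟦⟧-substAnn (let' N S) σc σo ρ ρ' e =
  cong₂ (λ a b → app (lam a) b)
        (⟦⟧-substAnn S (liftS σc) (liftS σo) (liftR ρ) (liftR ρ') e-let)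
        (trans (subst-rename σc ρ N) (trans (subst-ext e N) (sym (rename-subst ρ' σo N))))
  where
  e-let : ∀ i → liftS σc (liftR ρ i) ≡ rename (liftR ρ') (liftS σo i)
  e-let zero    = refl
  e-let (suc i) = trans (cong shift (e i))
                        (trans (rename-rename suc ρ' (σo i)) (sym (rename-rename (liftR ρ') suc (σo i))))
⟦⟧-substAnn (lam S)    σc σo ρ ρ' e =
  cong lam (⟦⟧-substAnn S (liftS σc) σo (suc ∘ ρ) (suc ∘ ρ') e-lam)
  where
  e-lam : ∀ i → liftS σc (suc (ρ i)) ≡ rename (suc ∘ ρ') (σo i)
  e-lam i = trans (cong shift (e i)) (rename-rename suc ρ' (σo i))

contract-substAnn : ∀ {d} (S : Ann d) σc σo τ κ →
                    contract (substAnn σc σo S) τ κ ≡ contract S (σc ⨾ τ) (σo ⨾ κ)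
contract-substAnn (base B)   σc σo τ κ = subst-subst τ σc B
contract-substAnn (app S t)  σc σo τ κ = cong₂ app (contract-substAnn S σc σo τ κ) (subst-subst τ σc t)
contract-substAnn (let' N S) σc σo τ κ =
  trans (contract-substAnn S (liftS σc) (liftS σo) (ext τ v) (ext κ v)) (contract-ext S eτ eκ)
  where
  v = subst κ (subst σo N)
  eτ : (liftS σc ⨾ ext τ v) ≐ ext (σc ⨾ τ) (subst (σo ⨾ κ) N)
  eτ zero    = subst-subst κ σo N
  eτ (suc i) = subst-ext-shift τ v (σc i)
  eκ : (liftS σo ⨾ ext κ v) ≐ ext (σo ⨾ κ) (subst (σo ⨾ κ) N)
  eκ zero    = subst-subst κ σo N
  eκ (suc i) = subst-ext-shift κ v (σo i)
contract-substAnn (lam S)    σc σo τ κ =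
  cong lam (trans (contract-substAnn S (liftS σc) σo (liftS τ) (shift ∘ κ)) (contract-ext S eτ eκ))
  where
  eτ : (liftS σc ⨾ liftS τ) ≐ liftS (σc ⨾ τ)
  eτ zero    = refl
  eτ (suc i) = sym (shift-subst τ (σc i))
  eκ : (σo ⨾ (shift ∘ κ)) ≐ (shift ∘ (σo ⨾ κ))
  eκ i = sym (rename-subst suc κ (σo i))

args-substAnn : ∀ {d} (S : Ann d) σc σo ε → args (substAnn σc σo S) ε ≡ args S (σo ⨾ ε)
args-substAnn (base B)   σc σo ε = refl
args-substAnn (app S t)  σc σo ε = args-substAnn S σc σo ε
args-substAnn (let' N S) σc σo ε =
  cong₂ _∷_ (subst-subst ε σo N)
            (trans (args-substAnn S (liftS σc) (liftS σo) (ext ε v)) (args-ext S eε))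
  where
  v = subst ε (subst σo N)
  eε : (liftS σo ⨾ ext ε v) ≐ ext (σo ⨾ ε) (subst (σo ⨾ ε) N)
  eε zero    = subst-subst ε σo N
  eε (suc i) = subst-ext-shift ε v (σo i)
args-substAnn (lam S)    σc σo ε = args-substAnn S (liftS σc) σo ε

subst-contract : ∀ {d} (S : Ann d) σ τ κ → subst σ (contract S τ κ) ≡ contract S (τ ⨾ σ) (κ ⨾ σ)
subst-contract (base B)   σ τ κ = subst-subst σ τ B
subst-contract (app S t)  σ τ κ = cong₂ app (subst-contract S σ τ κ) (subst-subst σ τ t)
subst-contract (let' N S) σ τ κ =
  trans (subst-contract S σ (ext τ v) (ext κ v)) (contract-ext S (agree τ) (agree κ))
  where
  v = subst κ N
  agree : ∀ θ → (ext θ v ⨾ σ) ≐ ext (θ ⨾ σ) (subst (κ ⨾ σ) N)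
  agree θ zero    = subst-subst σ κ N
  agree θ (suc i) = refl
subst-contract (lam S)    σ τ κ =
  cong lam (trans (subst-contract S (liftS σ) (liftS τ) (shift ∘ κ)) (contract-ext S eτ eκ))
  where
  eτ : (liftS τ ⨾ liftS σ) ≐ liftS (τ ⨾ σ)
  eτ zero    = refl
  eτ (suc i) = sym (shift-subst σ (τ i))
  eκ : ((shift ∘ κ) ⨾ liftS σ) ≐ (shift ∘ (κ ⨾ σ))
  eκ i = sym (shift-subst σ (κ i))

⟦⟧-embed : ∀ {d} (S : Ann inside) ρ → ⟦ embed {d} S ⟧ ρ ≡ ⟦ S ⟧ ρ
⟦⟧-embed (base B)   ρ = refl
⟦⟧-embed (let' N S) ρ = cong (λ a → app (lam a) (rename ρ N)) (⟦⟧-embed S (liftR ρ))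
⟦⟧-embed (lam S)    ρ = refl

contract-embed : ∀ {d} (S : Ann inside) τ κ → contract (embed {d} S) τ κ ≡ contract S τ κ
contract-embed (base B)   τ κ = refl
contract-embed (let' N S) τ κ = contract-embed S _ _
contract-embed (lam S)    τ κ = refl

args-embed : ∀ {d} (S : Ann inside) ε → args (embed {d} S) ε ≡ args S ε
args-embed (base B)   ε = refl
args-embed (let' N S) ε = cong (subst ε N ∷_) (args-embed S _)
args-embed (lam S)    ε = refl

-- The weight only depends on the shape, so it is invariant under
-- substitutions mapping variables to variables.

VarSub : Sub → Set
VarSub σ = ∀ i → Σ ℕ λ j → σ i ≡ var j

liftS-VarSub : ∀ {σ} → VarSub σ → VarSub (liftS σ)
liftS-VarSub v zero = zero , refl
liftS-VarSub v (suc i) with v i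
... | j , e = suc j , cong shift e

baseWeight-subst : ∀ σ → VarSub σ → ∀ B → baseWeight (subst σ B) ≡ baseWeight B
baseWeight-subst σ v (var x) with v x
... | j , e rewrite e = refl
baseWeight-subst σ v (lam B)   = cong suc (baseWeight-subst (liftS σ) (liftS-VarSub v) B)
baseWeight-subst σ v (app _ _) = refl

weight-substAnn : ∀ {d} (S : Ann d) σc σo → VarSub σc → weight (substAnn σc σo S) ≡ weight S
weight-substAnn (base B)   σc σo v = baseWeight-subst σc v B
weight-substAnn (app S t)  σc σo v = cong (2 *_) (weight-substAnn S σc σo v)
weight-substAnn (let' N S) σc σo v =
  cong (λ n → 2 * suc n) (weight-substAnn S (liftS σc) (liftS σo) (liftS-VarSub v))
weight-substAnn (lam S)    σc σo v = cong suc (weight-substAnn S (liftS σc) σo (liftS-VarSub v))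

_⟶*ᴾ_ : List Term → List Term → Set
_⟶*ᴾ_ = Pointwise _⟶*_

⟶*ᴾ-refl : ∀ l → l ⟶*ᴾ l
⟶*ᴾ-refl l = Pointwise.refl Star.ε

ext-mono : ∀ {σ σ' v v'} → (∀ i → σ i ⟶* σ' i) → v ⟶* v' → ∀ i → ext σ v i ⟶* ext σ' v' i
ext-mono h p zero    = p
ext-mono h p (suc i) = h i

contract-mono : ∀ {d} (S : Ann d) {τ τ' κ κ'} → (∀ i → τ i ⟶* τ' i) → (∀ i → κ i ⟶* κ' i) →
                contract S τ κ ⟶* contract S τ' κ'
contract-mono (base B)   hτ hκ = subst-mono hτ B
contract-mono (app S t)  hτ hκ = app* (contract-mono S hτ hκ) (subst-mono hτ t)
contract-mono (let' N S) hτ hκ =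
  contract-mono S (ext-mono hτ (subst-mono hκ N)) (ext-mono hκ (subst-mono hκ N))
contract-mono (lam S)    hτ hκ = lam* (contract-mono S (liftS-mono hτ) (λ i → rename-step* suc (hκ i)))

args-mono : ∀ {d} (S : Ann d) {ε ε'} → (∀ i → ε i ⟶* ε' i) → args S ε ⟶*ᴾ args S ε'
args-mono (base B)   h = []
args-mono (app S t)  h = args-mono S h
args-mono (let' N S) h = subst-mono h N ∷ args-mono S (ext-mono h (subst-mono h N))
args-mono (lam S)    h = args-mono S h

open Multiset _<⁺_

infix 4 _<ₘ_
_<ₘ_ : (List Term × ℕ) → (List Term × ℕ) → Set
(l' , n') <ₘ (l , n) = DM⁺ l' l ⊎ ((l ≡ l') × (n' < n))

acc-<ₘ : ∀ {l} → Acc DM⁺ l → ∀ {n} → Acc _<_ n → Acc _<ₘ_ (l , n)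
acc-<ₘ-step : ∀ {l} → Acc DM⁺ l → ∀ {n} → Acc _<_ n → ∀ {p} → p <ₘ (l , n) → Acc _<ₘ_ p
acc-<ₘ al an = acc (acc-<ₘ-step al an)
acc-<ₘ-step (acc hl) an (inj₁ d)             = acc-<ₘ (hl d) (<-wellFounded _)
acc-<ₘ-step al (acc hn) (inj₂ (refl , lt)) = acc-<ₘ al (hn lt)

⟶*-<⁺ : ∀ {a b} → a ⟶* b → (a ≡ b) ⊎ (b <⁺ a)
⟶*-<⁺ Star.ε = inj₁ refl
⟶*-<⁺ (s ◅ p) with ⟶*-<⁺ p
... | inj₁ refl = inj₂ [ inj₁ s ]
... | inj₂ q    = inj₂ (q ∷ʳ inj₁ s)

⟶⁺-<⁺ : ∀ {a b} → a ⟶⁺ b → b <⁺ a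
⟶⁺-<⁺ (u , s , p) with ⟶*-<⁺ p
... | inj₁ refl = [ inj₁ s ]
... | inj₂ q    = q ∷ʳ inj₁ s

⟶*ᴾ-DM : ∀ {l l'} → l ⟶*ᴾ l' → (l ≡ l') ⊎ DM⁺ l' l
⟶*ᴾ-DM [] = inj₁ refl
⟶*ᴾ-DM {a ∷ l} {b ∷ l'} (p ∷ ps) with ⟶*-<⁺ p | ⟶*ᴾ-DM ps
... | inj₁ refl | inj₁ refl = inj₁ refl
... | inj₁ refl | inj₂ d    = inj₂ (DM⁺-∷ d)
... | inj₂ b<a  | rest      = inj₂ (tail-then-head rest)
  where
  head-step : DMStep (b ∷ l) (a ∷ l)
  head-step = a , l , b ∷ [] , ↭-refl , ↭-refl , (b<a ∷ [])
  tail-then-head : (l ≡ l') ⊎ DM⁺ l' l → DM⁺ (b ∷ l') (a ∷ l)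
  tail-then-head (inj₁ refl) = [ head-step ]
  tail-then-head (inj₂ d)    = DM⁺-∷ d Plus.++ [ head-step ]

DMStep-then-⟶*ᴾ : ∀ {l l₁ l'} → DMStep l₁ l → l₁ ⟶*ᴾ l' → DM⁺ l' l
DMStep-then-⟶*ᴾ d ps with ⟶*ᴾ-DM ps
... | inj₁ refl = [ d ]
... | inj₂ d'   = d' Plus.++ [ d ]

data Decrease (c : Term) (as : List Term) (n : ℕ) (c' : Term) (as' : List Term) (n' : ℕ) : Set where
  by-contract : c ⟶⁺ c' → (new as₀ : List Term) → All (_<⁺ c) new → as ⟶*ᴾ as₀ →
                as' ↭ new ++ as₀ → Decrease c as n c' as' n'
  by-args     : c ⟶* c' → (as₁ : List Term) → DMStep as₁ as → as₁ ⟶*ᴾ as' →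
                Decrease c as n c' as' n'
  by-weight   : c ≡ c' → as ≡ as' → n' < n → Decrease c as n c' as' n'

Decrease⇒<ₘ : ∀ {c as n c' as' n'} → Decrease c as n c' as' n' → (c' ∷ as' , n') <ₘ (c ∷ as , n)
Decrease⇒<ₘ {c} {as} {c' = c'} (by-contract p new as₀ below ps r) =
  inj₁ (DM⁺-↭ (prep c' r) (DMStep-then-⟶*ᴾ replace-c (Star.ε ∷ Pointwise.++⁺ (⟶*ᴾ-refl new) ps)))
  where
  replace-c : DMStep (c' ∷ new ++ as) (c ∷ as)
  replace-c = c , as , c' ∷ new , ↭-refl , ↭-refl , (⟶⁺-<⁺ p ∷ below)
Decrease⇒<ₘ (by-args p as₁ d ps)    = inj₁ (DMStep-then-⟶*ᴾ (DMStep-∷ d) (p ∷ ps))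
Decrease⇒<ₘ (by-weight refl refl lt) = inj₂ (refl , lt)

Decrease-app : ∀ {c as n c' as' n'} t → Decrease c as n c' as' n' →
               Decrease (app c t) as (2 * n) (app c' t) as' (2 * n')
Decrease-app t (by-contract (u , s , p) new as₀ below ps r) =
  by-contract (app u t , ξappl s , appl* t p) new as₀ (All.map (Plus._++ <⁺-sub sub-l) below) ps r
Decrease-app t (by-args p as₁ d ps)    = by-args (appl* t p) as₁ d ps
Decrease-app t (by-weight refl refl lt) = by-weight refl refl (*-monoʳ-< 2 lt)

Decrease-lam : ∀ {c as n c' as' n'} → Decrease c as n c' as' n' →
               Decrease (lam c) as (suc n) (lam c') as' (suc n')
Decrease-lam (by-contract (u , s , p) new as₀ below ps r) =
  by-contract (lam u , ξlam s , lam* p) new as₀ (All.map (Plus._++ <⁺-sub sub-lam) below) ps r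
Decrease-lam (by-args p as₁ d ps)    = by-args (lam* p) as₁ d ps
Decrease-lam (by-weight refl refl lt) = by-weight refl refl (s≤s lt)

Decrease-let : ∀ {c as n c' as' n'} v → Decrease c as n c' as' n' →
               Decrease c (v ∷ as) (2 * suc n) c' (v ∷ as') (2 * suc n')
Decrease-let v (by-contract p new as₀ below ps r) =
  by-contract p new (v ∷ as₀) below (Star.ε ∷ ps) (↭-trans (prep v r) (↭-sym (↭-shift v new as₀)))
Decrease-let v (by-args p as₁ d ps)    = by-args p (v ∷ as₁) (DMStep-∷ d) (Star.ε ∷ ps)
Decrease-let v (by-weight refl refl lt) = by-weight refl refl (*-monoʳ-< 2 (s≤s lt))

-- A frame describes where an annotation sits:
-- ρ maps the outer scope into the current one, τ and κ are the
-- substitutions used to contract (in the current and the outer scope, so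
-- that κ = τ ∘ ρ), and ε is the substitution used for the arguments.
-- Outside every abstraction the two scopes coincide.

Consistent : Ren → Sub → Sub → Set
Consistent ρ τ κ = ∀ i → κ i ≡ τ (ρ i)

OuterFrame : Depth → Ren → Sub → Sub → Set
OuterFrame outside ρ κ ε = (∀ i → ρ i ≡ i) × (κ ≐ ε)
OuterFrame inside  ρ κ ε = ⊤

consistent-let : ∀ ρ τ κ v → Consistent ρ τ κ → Consistent (liftR ρ) (ext τ v) (ext κ v)
consistent-let ρ τ κ v c zero    = refl
consistent-let ρ τ κ v c (suc i) = c i

outer-let : ∀ {d} ρ κ ε N → OuterFrame d ρ κ ε →
            OuterFrame d (liftR ρ) (ext κ (subst κ N)) (ext ε (subst ε N))
outer-let {outside} ρ κ ε N (ρ-id , κ≐ε) = liftR-id , ext-ext κ≐ε (subst-ext κ≐ε N)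
  where
  liftR-id : ∀ i → liftR ρ i ≡ i
  liftR-id zero    = refl
  liftR-id (suc i) = cong suc (ρ-id i)
outer-let {inside} ρ κ ε N tt = tt

SuccessorAt : ∀ {d} → ℕ → Ann d → Ren → Sub → Sub → Sub → Term → Set
SuccessorAt {d} n S ρ τ κ ε X = Σ (Ann d) λ S' → (X ≡ ⟦ S' ⟧ ρ) ×
  Decrease (contract S τ κ) (args S ε) n (contract S' τ κ) (args S' ε) (weight S')

Successor : ∀ {d} → Ann d → Ren → Sub → Sub → Sub → Term → Set
Successor S = SuccessorAt (weight S) S

β-subst : ∀ σ Q P → app (lam (subst (liftS σ) Q)) (subst σ P) ⟶ subst (ext σ (subst σ P)) Q
β-subst σ Q P = ⟶-resp-≡ β (trans (subst-subst _ (liftS σ) Q) (subst-ext agree Q))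
  where
  agree : (subst (single (subst σ P)) ∘ liftS σ) ≐ ext σ (subst σ P)
  agree zero    = refl
  agree (suc i) = subst-single-shift _ (σ i)

δ-weight : ∀ k → suc (2 * suc k) < 2 * suc (suc k)
δ-weight k = ≤-reflexive (sym (*-suc 2 (suc k)))

γ-weight : ∀ k → 2 * suc (2 * k) < 2 * (2 * suc k)
γ-weight k = ≡.subst (2 * suc (2 * k) <_) (sym (cong (2 *_) (*-suc 2 k)))
                     (≤-trans (n≤1+n _) (δ-weight (2 * k)))

-- β contracts the marked redex: the contractum is unchanged and its
-- argument disappears from the list.
β-let : ∀ {d} N (S : Ann d) ρ τ κ ε → Consistent ρ τ κ →
        Successor (let' N S) ρ τ κ ε ((⟦ S ⟧ (liftR ρ)) [0:= rename ρ N ])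
β-let N S ρ τ κ ε cons = S' , eqX , by-args (≡⇒⟶* contract-eq) (args S' ε) drop-N (⟶*ᴾ-refl _)
  where
  σc = single (rename ρ N)
  σo = single N
  S' = substAnn σc σo S
  eqX = ⟦⟧-substAnn S σc σo (liftR ρ) ρ λ { zero → refl ; (suc i) → refl }
  v = subst κ N
  eτ : (σc ⨾ τ) ≐ ext τ v
  eτ zero    = trans (subst-rename τ ρ N) (subst-ext (λ i → sym (cons i)) N)
  eτ (suc i) = refl
  contract-eq : contract S (ext τ v) (ext κ v) ≡ contract S' τ κ
  contract-eq = sym (trans (contract-substAnn S σc σo τ κ)
                            (contract-ext S eτ λ { zero → refl ; (suc i) → refl }))
  args-eq : args S' ε ≡ args S (ext ε (subst ε N))
  args-eq = trans (args-substAnn S σc σo ε) (args-ext S λ { zero → refl ; (suc i) → refl })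
  drop-N : DMStep (args S' ε) (args (let' N S) ε)
  drop-N = subst ε N , args S (ext ε (subst ε N)) , [] , ↭-refl , ↭-reflexive args-eq , []

-- δ moves the let below the abstraction: contractum and arguments are
-- unchanged, the weight decreases.
δ-let : ∀ {d} N (S : Ann inside) ρ τ κ ε →
        Successor {d} (let' N (lam S)) ρ τ κ ε
                  (lam (app (lam (rename swap01 (⟦ S ⟧ (suc ∘ liftR ρ)))) (shift (rename ρ N))))
δ-let {d} N S ρ τ κ ε = S' , eqX , by-weight contract-eq args-eq weight-lt
  where
  Sswap = substAnn (var ∘ swap01) var S
  S' : Ann d
  S' = lam (let' N Sswap)
  eqX = cong₂ (λ a b → lam (app (lam a) b))
          (trans (rename-as-subst swap01 _)
                 (⟦⟧-substAnn S (var ∘ swap01) var (suc ∘ liftR ρ) (liftR (suc ∘ ρ))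
                              λ { zero → refl ; (suc i) → refl }))
          (rename-rename suc ρ N)
  v = subst κ N
  eτ : ((var ∘ swap01) ⨾ ext (liftS τ) (subst (shift ∘ κ) N)) ≐ liftS (ext τ v)
  eτ zero          = refl
  eτ (suc zero)    = sym (rename-subst suc κ N)
  eτ (suc (suc i)) = refl
  eκ : (var ⨾ ext (shift ∘ κ) (subst (shift ∘ κ) N)) ≐ (shift ∘ ext κ v)
  eκ zero    = sym (rename-subst suc κ N)
  eκ (suc i) = refl
  contract-eq : contract (let' {d} N (lam S)) τ κ ≡ contract S' τ κ
  contract-eq = cong lam (sym (trans (contract-substAnn S (var ∘ swap01) var _ _) (contract-ext S eτ eκ)))
  args-eq : args (let' {d} N (lam S)) ε ≡ args S' ε
  args-eq = cong (subst ε N ∷_) (sym (trans (args-substAnn S (var ∘ swap01) var _) (args-ext S (λ i → refl))))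
  weight-lt : weight S' < weight (let' {d} N (lam S))
  weight-lt = ≡.subst (λ k → suc (2 * suc k) < 2 * suc (suc (weight S)))
                      (sym (weight-substAnn S (var ∘ swap01) var (λ i → _ , refl))) (δ-weight (weight S))

-- assoc with a redex (λ.Q) P as argument of the let: it becomes two nested
-- lets.  The contractum reduces by contracting (λ.Q) P; in the argument
-- list, (λ.Q) P is replaced by its subterm P and its reduct Q[P].
assoc-let : ∀ {d} Q P (S : Ann d) ρ τ κ ε →
            Successor (let' (app (lam Q) P) S) ρ τ κ ε
                      (app (lam (app (shift (lam (⟦ S ⟧ (liftR ρ)))) (rename (liftR ρ) Q))) (rename ρ P))
assoc-let Q P S ρ τ κ ε = S' , eqX , by-args contract-red new-args replace-redex reduce-rest
  where
  σ = var ∘ liftR suc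
  Sw = substAnn σ σ S
  S' = let' P (let' Q Sw)
  eqX = cong (λ a → app (lam (app (lam a) (rename (liftR ρ) Q))) (rename ρ P))
             (trans (rename-as-subst (liftR suc) _)
                    (⟦⟧-substAnn S σ σ (liftR ρ) (liftR (liftR ρ)) λ { zero → refl ; (suc i) → refl }))
  skip : ∀ θ p q → (σ ⨾ ext (ext θ p) q) ≐ ext θ q
  skip θ p q zero    = refl
  skip θ p q (suc i) = refl
  qκ = subst (ext κ (subst κ P)) Q
  contract-eq : contract S' τ κ ≡ contract S (ext τ qκ) (ext κ qκ)
  contract-eq = trans (contract-substAnn S σ σ _ _) (contract-ext S (skip τ _ qκ) (skip κ _ qκ))
  redex-κ : subst κ (app (lam Q) P) ⟶* qκ
  redex-κ = β-subst κ Q P ◅ Star.ε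
  contract-red : contract (let' (app (lam Q) P) S) τ κ ⟶* contract S' τ κ
  contract-red = contract-mono S (ext-mono (λ _ → Star.ε) redex-κ) (ext-mono (λ _ → Star.ε) redex-κ)
                 ◅◅ ≡⇒⟶* (sym contract-eq)
  wε = subst ε (app (lam Q) P)
  pε = subst ε P
  qε = subst (ext ε pε) Q
  new-args = pε ∷ qε ∷ args S (ext ε wε)
  replace-redex : DMStep new-args (args (let' (app (lam Q) P) S) ε)
  replace-redex = wε , args S (ext ε wε) , pε ∷ qε ∷ [] , ↭-refl , ↭-refl ,
                  (<⁺-sub sub-r ∷ [ inj₁ (β-subst ε Q P) ] ∷ [])
  args-eq : args S (ext ε qε) ≡ args Sw (ext (ext ε pε) qε)
  args-eq = sym (trans (args-substAnn S σ σ _) (args-ext S (skip ε pε qε)))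
  reduce-rest : new-args ⟶*ᴾ args S' ε
  reduce-rest = Star.ε ∷ Star.ε ∷
    ≡.subst (args S (ext ε wε) ⟶*ᴾ_) args-eq
            (args-mono S (ext-mono (λ _ → Star.ε) (β-subst ε Q P ◅ Star.ε)))

-- γ with a let as function: the application moves below the let;
-- contractum and arguments are unchanged, the weight decreases.
γ-let : ∀ N (S : Ann outside) t ρ τ κ ε →
        Successor (app (let' N S) t) ρ τ κ ε (app (lam (app (⟦ S ⟧ (liftR ρ)) (shift t))) (rename ρ N))
γ-let N S t ρ τ κ ε =
  let' N (app S (shift t)) , refl ,
  by-weight (cong (app _) (sym (subst-ext-shift τ (subst κ N) t))) refl (γ-weight (weight S))

-- Steps at an application node whose redex is an unmarked one built from
-- the annotation: it becomes marked.  Applications occur only outside every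
-- abstraction, where ρ is the identity and κ = ε, so the argument of the
-- new let is already in the outer scope.  In each case the contractum
-- reduces by one β-step and the new argument is a subterm of the old
-- contractum.  As the decrease does not use the weight, it holds for any
-- weight of the source: the same redex may be split differently between
-- annotation and unannotated parts.
module AppRedex (ρ : Ren) (τ κ ε : Sub) (cons : Consistent ρ τ κ) (outer : OuterFrame outside ρ κ ε) where

  ρ-id : ∀ i → ρ i ≡ i
  ρ-id = proj₁ outer

  τ≐κ : τ ≐ κ
  τ≐κ i = trans (cong τ (sym (ρ-id i))) (sym (cons i))

  τ-as-ε : ∀ t → subst τ t ≡ subst ε t
  τ-as-ε = subst-ext (λ i → trans (τ≐κ i) (proj₂ outer i))

  arg-below : ∀ a {c} → subst τ a <⁺ c → subst ε a <⁺ c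
  arg-below a {c} = ≡.subst (_<⁺ c) (τ-as-ε a)

  -- β on an abstraction applied to t: the contractum makes the same step.
  β-app : ∀ (S : Ann inside) t {n} →
          SuccessorAt n (app (lam S) t) ρ τ κ ε ((⟦ S ⟧ (suc ∘ ρ)) [0:= t ])
  β-app S t = S' , eqX , by-contract (_ , ⟶-resp-≡ β contract-eq , Star.ε) [] (args S ε) []
                                      (⟶*ᴾ-refl _) (↭-reflexive args-eq)
    where
    St = substAnn (single t) var S
    S' : Ann outside
    S' = embed St
    eqX = trans (⟦⟧-substAnn S (single t) var (suc ∘ ρ) ρ (λ i → refl)) (sym (⟦⟧-embed St ρ))
    tτ = subst τ t
    eτ : (liftS τ ⨾ single tτ) ≐ (single t ⨾ τ)
    eτ zero    = refl
    eτ (suc i) = subst-single-shift tτ (τ i)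
    contract-eq : (contract S (liftS τ) (shift ∘ κ)) [0:= tτ ] ≡ contract S' τ κ
    contract-eq = begin
      (contract S (liftS τ) (shift ∘ κ)) [0:= tτ ]
        ≡⟨ subst-contract S (single tτ) _ _ ⟩
      contract S (liftS τ ⨾ single tτ) ((shift ∘ κ) ⨾ single tτ)
        ≡⟨ contract-ext S eτ (λ i → subst-single-shift tτ (κ i)) ⟩
      contract S (single t ⨾ τ) (var ⨾ κ)
        ≡⟨ contract-substAnn S (single t) var τ κ ⟨
      contract St τ κ
        ≡⟨ contract-embed St τ κ ⟨
      contract S' τ κ
        ∎
    args-eq : args S' ε ≡ args S ε
    args-eq = trans (args-embed St ε) (trans (args-substAnn S (single t) var ε) (args-ext S (λ i → refl)))

  -- δ on a double abstraction applied to t: in the contractum this is a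
  -- β-step; t becomes the argument of a new let below the outer abstraction.
  δ-app : ∀ (S : Ann inside) t {n} →
          SuccessorAt n (app (lam (lam S)) t) ρ τ κ ε
                      (lam (app (lam (rename swap01 (⟦ S ⟧ (suc ∘ (suc ∘ ρ))))) (shift t)))
  δ-app S t = S' , eqX , by-contract (_ , ⟶-resp-≡ β contract-eq , Star.ε) (subst ε t ∷ []) (args S ε)
                                      (arg-below t (<⁺-sub sub-r) ∷ []) (⟶*ᴾ-refl _) (↭-reflexive args-eq)
    where
    S' : Ann outside
    S' = lam (let' t (substAnn (var ∘ swap01) (var ∘ suc) S))
    eqX = cong₂ (λ a b → lam (app (lam a) b))
            (trans (rename-as-subst swap01 _)
                   (⟦⟧-substAnn S (var ∘ swap01) (var ∘ suc) (suc ∘ (suc ∘ ρ)) (liftR (suc ∘ ρ))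
                                (λ i → refl)))
            (rename-ext (λ i → cong suc (sym (ρ-id i))) t)
    tτ = subst τ t
    w = subst (shift ∘ κ) t
    shift²-single : ∀ x → subst (liftS (single tτ)) (shift (shift x)) ≡ shift x
    shift²-single x = trans (sym (shift-subst (single tτ) (shift x))) (cong shift (subst-single-shift tτ x))
    eτ : (liftS (liftS τ) ⨾ liftS (single tτ)) ≐ ((var ∘ swap01) ⨾ ext (liftS τ) w)
    eτ zero          = refl
    eτ (suc zero)    = trans (rename-subst suc τ t) (subst-ext (λ i → cong shift (τ≐κ i)) t)
    eτ (suc (suc i)) = shift²-single (τ i)
    contract-eq : (lam (contract S (liftS (liftS τ)) (shift ∘ (shift ∘ κ)))) [0:= tτ ] ≡ contract S' τ κ
    contract-eq = cong lam (trans (subst-contract S (liftS (single tτ)) _ _)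
                                  (trans (contract-ext S eτ (λ i → shift²-single (κ i)))
                                         (sym (contract-substAnn S (var ∘ swap01) (var ∘ suc) _ _))))
    args-eq : args S' ε ≡ subst ε t ∷ args S ε
    args-eq = cong (subst ε t ∷_)
                   (trans (args-substAnn S (var ∘ swap01) (var ∘ suc) _) (args-ext S (λ i → refl)))

  -- γ on (λ.S) N applied to t: in the contractum this is a β-step in
  -- function position; N becomes the argument of a new let.
  γ-app : ∀ (S : Ann inside) N t {n} →
          SuccessorAt n (app (app (lam S) N) t) ρ τ κ ε (app (lam (app (⟦ S ⟧ (suc ∘ ρ)) (shift t))) N)
  γ-app S N t = S' , eqX , by-contract (_ , ξappl (⟶-resp-≡ β contract-eq) , ≡⇒⟶* app-eq)
                                        (subst ε N ∷ []) (args S ε)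
                                        (arg-below N (<⁺-sub sub-r Plus.++ <⁺-sub sub-l) ∷ [])
                                        (⟶*ᴾ-refl _) (↭-reflexive args-eq)
    where
    Sw = substAnn var (var ∘ suc) S
    S' : Ann outside
    S' = let' N (app (embed Sw) (shift t))
    eqX = cong₂ (λ a b → app (lam (app a (shift t))) b)
            (trans (sym (subst-var _))
                   (trans (⟦⟧-substAnn S var (var ∘ suc) (suc ∘ ρ) (liftR ρ) (λ i → refl))
                          (sym (⟦⟧-embed Sw (liftR ρ)))))
            (sym (rename-id ρ-id N))
    Nτ = subst τ N
    v = subst κ N
    eτ : (liftS τ ⨾ single Nτ) ≐ (var ⨾ ext τ v)
    eτ zero    = subst-ext τ≐κ N
    eτ (suc i) = subst-single-shift Nτ (τ i)
    contract-eq : (contract S (liftS τ) (shift ∘ κ)) [0:= Nτ ] ≡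
                  contract (embed {outside} Sw) (ext τ v) (ext κ v)
    contract-eq = trans (subst-contract S (single Nτ) _ _)
                        (trans (contract-ext S eτ (λ i → subst-single-shift Nτ (κ i)))
                               (sym (trans (contract-embed Sw _ _) (contract-substAnn S var (var ∘ suc) _ _))))
    app-eq : app (contract (embed {outside} Sw) (ext τ v) (ext κ v)) (subst τ t) ≡ contract S' τ κ
    app-eq = cong (app _) (sym (subst-ext-shift τ v t))
    args-eq : args S' ε ≡ subst ε N ∷ args S ε
    args-eq = cong (subst ε N ∷_)
                   (trans (args-embed Sw _) (trans (args-substAnn S var (var ∘ suc) _) (args-ext S (λ i → refl))))

  -- assoc with argument (λ.Q) P: in the contractum this is a β-step in
  -- argument position; P becomes the argument of a new let.
  assoc-app : ∀ (S : Ann outside) Q P {n} →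
              SuccessorAt n (app S (app (lam Q) P)) ρ τ κ ε (app (lam (app (shift (⟦ S ⟧ ρ)) Q)) P)
  assoc-app S Q P = S' , eqX , by-contract (_ , ξappr (⟶-resp-≡ β contract-eq) , ≡⇒⟶* app-eq)
                                            (subst ε P ∷ []) (args S ε)
                                            (arg-below P (<⁺-sub sub-r Plus.++ <⁺-sub sub-r) ∷ [])
                                            (⟶*ᴾ-refl _) (↭-reflexive args-eq)
    where
    Sw = substAnn (var ∘ suc) (var ∘ suc) S
    S' : Ann outside
    S' = let' P (app Sw Q)
    eqX = cong₂ (λ a b → app (lam (app a Q)) b)
            (trans (rename-as-subst suc _)
                   (⟦⟧-substAnn S (var ∘ suc) (var ∘ suc) ρ (liftR ρ) (λ i → refl)))
            (sym (rename-id ρ-id P))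
    Pτ = subst τ P
    p = subst κ P
    eτ : (subst (single Pτ) ∘ liftS τ) ≐ ext τ p
    eτ zero    = subst-ext τ≐κ P
    eτ (suc i) = subst-single-shift Pτ (τ i)
    contract-eq : (subst (liftS τ) Q) [0:= Pτ ] ≡ subst (ext τ p) Q
    contract-eq = trans (subst-subst _ (liftS τ) Q) (subst-ext eτ Q)
    app-eq : app (contract S τ κ) (subst (ext τ p) Q) ≡ contract S' τ κ
    app-eq = cong (λ a → app a (subst (ext τ p) Q))
                  (sym (trans (contract-substAnn S (var ∘ suc) (var ∘ suc) _ _)
                              (contract-ext S (λ i → refl) (λ i → refl))))
    args-eq : args S' ε ≡ subst ε P ∷ args S ε
    args-eq = cong (subst ε P ∷_)
                   (trans (args-substAnn S (var ∘ suc) (var ∘ suc) _) (args-ext S (λ i → refl)))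

-- By cases on the position of the
-- redex: inside an unannotated part or an argument the contractum
-- reduces; at a let node the redex is the marked one (β, δ) or the
-- argument is a redex (assoc); at an application node the redex is formed
-- with the annotation and becomes marked (β, δ, γ, assoc) or contains a let
-- (γ); the remaining cases are congruences.
step-decreases : ∀ {d} (S : Ann d) ρ τ κ ε → Consistent ρ τ κ → OuterFrame d ρ κ ε →
                 ∀ {X} → ⟦ S ⟧ ρ ⟶ X → Successor S ρ τ κ ε X
let-step-decreases : ∀ {d} N (S : Ann d) ρ τ κ ε → Consistent ρ τ κ → OuterFrame d ρ κ ε →
                     ∀ {Y N' X} → app (lam Y) N' ⟶ X → ⟦ S ⟧ (liftR ρ) ≡ Y → rename ρ N ≡ N' →
                     Successor (let' N S) ρ τ κ ε X
app-step-decreases : ∀ (S : Ann outside) t ρ τ κ ε → Consistent ρ τ κ → OuterFrame outside ρ κ ε →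
                     ∀ {Z X} → app Z t ⟶ X → ⟦ S ⟧ ρ ≡ Z → Successor (app S t) ρ τ κ ε X

step-decreases (base B) ρ τ κ ε cons outer s =
  base _ , refl , by-contract (_ , subst-step τ s , Star.ε) [] [] [] [] ↭-refl
step-decreases (lam S) ρ τ κ ε cons outer (ξlam s)
  with step-decreases S (suc ∘ ρ) (liftS τ) (shift ∘ κ) ε (λ i → cong shift (cons i)) tt s
... | S' , refl , dec = lam S' , refl , Decrease-lam dec
step-decreases (let' N S) ρ τ κ ε cons outer s = let-step-decreases N S ρ τ κ ε cons outer s refl refl
step-decreases (app S t)  ρ τ κ ε cons outer s = app-step-decreases S t ρ τ κ ε cons outer s refl

let-step-decreases N S        ρ τ κ ε cons outer β refl refl = β-let N S ρ τ κ ε cons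
let-step-decreases N (base B) ρ τ κ ε cons outer δ refl refl = δ-let N (base _) ρ τ κ ε
let-step-decreases N (lam S)  ρ τ κ ε cons outer δ refl refl = δ-let N S ρ τ κ ε
let-step-decreases N S ρ τ κ ε cons outer assoc refl eqN with rename-app-inv ρ N eqN
... | N₁ , P , refl , e₁ , refl with rename-lam-inv ρ N₁ e₁
... | Q , refl , refl = assoc-let Q P S ρ τ κ ε
let-step-decreases N S ρ τ κ ε cons outer (ξappl (ξlam s)) refl refl
  with step-decreases S (liftR ρ) (ext τ (subst κ N)) (ext κ (subst κ N)) (ext ε (subst ε N))
                      (consistent-let ρ τ κ (subst κ N) cons) (outer-let ρ κ ε N outer) s
... | S' , refl , dec = let' N S' , refl , Decrease-let (subst ε N) dec
let-step-decreases N S ρ τ κ ε cons outer (ξappr s) refl refl with rename-reflect ρ N refl s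
... | N' , s' , refl = let' N' S , refl , by-args contract-red _ replace-N reduce-rest
  where
  N-red : ∀ σ → subst σ N ⟶* subst σ N'
  N-red σ = subst-step σ s' ◅ Star.ε
  contract-red = contract-mono S (ext-mono (λ _ → Star.ε) (N-red κ)) (ext-mono (λ _ → Star.ε) (N-red κ))
  replace-N : DMStep (subst ε N' ∷ args S (ext ε (subst ε N))) (args (let' N S) ε)
  replace-N = subst ε N , args S (ext ε (subst ε N)) , subst ε N' ∷ [] , ↭-refl , ↭-refl ,
              ([ inj₁ (subst-step ε s') ] ∷ [])
  reduce-rest = Star.ε ∷ args-mono S (ext-mono (λ _ → Star.ε) (N-red ε))

app-step-decreases (lam S) t ρ τ κ ε cons outer β refl = β-app S t
  where open AppRedex ρ τ κ ε cons outer
app-step-decreases (base (lam M)) t ρ τ κ ε cons outer β refl = β-app (base M) t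
  where open AppRedex ρ τ κ ε cons outer
app-step-decreases (lam (lam S)) t ρ τ κ ε cons outer δ refl = δ-app S t
  where open AppRedex ρ τ κ ε cons outer
app-step-decreases (lam (base (lam M))) t ρ τ κ ε cons outer δ refl = δ-app (base M) t
  where open AppRedex ρ τ κ ε cons outer
app-step-decreases (base (lam (lam M))) t ρ τ κ ε cons outer δ refl = δ-app (base M) t
  where open AppRedex ρ τ κ ε cons outer
app-step-decreases (let' N S) t ρ τ κ ε cons outer γ refl = γ-let N S t ρ τ κ ε
app-step-decreases (app (lam S) N) t ρ τ κ ε cons outer γ refl = γ-app S N t
  where open AppRedex ρ τ κ ε cons outer
app-step-decreases (app (base (lam M)) N) t ρ τ κ ε cons outer γ refl = γ-app (base M) N t
  where open AppRedex ρ τ κ ε cons outer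
app-step-decreases (base (app (lam M) N)) t ρ τ κ ε cons outer γ refl = γ-app (base M) N t
  where open AppRedex ρ τ κ ε cons outer
app-step-decreases S (app (lam Q) P) ρ τ κ ε cons outer assoc refl = assoc-app S Q P
  where open AppRedex ρ τ κ ε cons outer
app-step-decreases S t ρ τ κ ε cons outer (ξappl s) refl with step-decreases S ρ τ κ ε cons outer s
... | S' , refl , dec = app S' t , refl , Decrease-app (subst τ t) dec
app-step-decreases S t ρ τ κ ε cons outer (ξappr s) refl =
  app S _ , refl , by-contract (_ , ξappr (subst-step τ s) , Star.ε) [] (args S ε) [] (⟶*ᴾ-refl _) ↭-refl

SN⟶ : Term → Set
SN⟶ = SN _⟶_

sn-lam : ∀ {t} → SN⟶ t → SN⟶ (lam t)
sn-lam (acc h) = acc λ { (ξlam s) → sn-lam (h s) }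

sn-reading-acc : ∀ (S : Ann outside) → Acc _<ₘ_ (contract S var var ∷ args S var , weight S) →
                 SN⟶ (⟦ S ⟧ id)
sn-reading-acc S (acc h) =
  acc λ s → next (step-decreases S id var var var (λ i → refl) ((λ i → refl) , (λ i → refl)) s)
  where
  next : ∀ {X} → Successor S id var var var X → SN⟶ X
  next (S' , refl , dec) = sn-reading-acc S' (h (Decrease⇒<ₘ dec))

sn-reading : ∀ (S : Ann outside) → SN⟶ (contract S var var) → All SN⟶ (args S var) → SN⟶ (⟦ S ⟧ id)
sn-reading S sn-c sn-as =
  sn-reading-acc S (acc-<ₘ (acc-DM⁺ _ (All.map Full.acc-≺⁺ (sn-c ∷ sn-as))) (<-wellFounded (weight S)))

-- A term applied to a list of arguments, the last argument first.

apps : Term → List Term → Term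
apps F []       = F
apps F (t ∷ ts) = app (apps F ts) t

apps-++ : ∀ F ts₂ ts₁ → apps F (ts₂ ++ ts₁) ≡ apps (apps F ts₁) ts₂
apps-++ F []        ts₁ = refl
apps-++ F (t ∷ ts₂) ts₁ = cong (λ u → app u t) (apps-++ F ts₂ ts₁)

appsAnn : Ann outside → List Term → Ann outside
appsAnn S []       = S
appsAnn S (t ∷ ts) = app (appsAnn S ts) t

⟦⟧-appsAnn : ∀ S ts → ⟦ appsAnn S ts ⟧ id ≡ apps (⟦ S ⟧ id) ts
⟦⟧-appsAnn S []       = refl
⟦⟧-appsAnn S (t ∷ ts) = cong (λ u → app u t) (⟦⟧-appsAnn S ts)

contract-appsAnn : ∀ S ts → contract (appsAnn S ts) var var ≡ apps (contract S var var) ts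
contract-appsAnn S []       = refl
contract-appsAnn S (t ∷ ts) = cong₂ app (contract-appsAnn S ts) (subst-var t)

args-appsAnn : ∀ S ts → args (appsAnn S ts) var ≡ args S var
args-appsAnn S []       = refl
args-appsAnn S (t ∷ ts) = args-appsAnn S ts

-- This is
-- the main lemma for the annotation marking that one redex.
sn-expand : ∀ M N ts → SN⟶ (apps (M [0:= N ]) ts) → SN⟶ N → SN⟶ (apps (app (lam M) N) ts)
sn-expand M N ts sn-c sn-N = ≡.subst SN⟶ denotation (sn-reading S sn-contract sn-args)
  where
  S = appsAnn (let' N (base M)) ts
  denotation : ⟦ S ⟧ id ≡ apps (app (lam M) N) ts
  denotation = trans (⟦⟧-appsAnn _ ts) (cong (λ u → apps (app (lam M) u) ts) (rename-id (λ i → refl) N))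
  contract-eq : apps (M [0:= N ]) ts ≡ contract S var var
  contract-eq = begin
    apps (M [0:= N ]) ts                                       ≡⟨ cong (λ u → apps u ts) (subst-ext agree M) ⟨
    apps (subst (ext var (subst var N)) M) ts                  ≡⟨ contract-appsAnn _ ts ⟨
    contract S var var                                         ∎
    where
    agree : ext var (subst var N) ≐ single N
    agree zero    = subst-var N
    agree (suc i) = refl
  sn-contract : SN⟶ (contract S var var)
  sn-contract = ≡.subst SN⟶ contract-eq sn-c
  sn-args : All SN⟶ (args S var)
  sn-args = ≡.subst (All SN⟶) (sym (args-appsAnn _ ts)) (≡.subst SN⟶ (sym (subst-var N)) sn-N ∷ [])

-- Variable spines.  A step of x ts either reduces one argument, or is an
-- assoc-step at some argument (λ.Q) P, producing a redex applied to the
-- remaining arguments.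

data OneStep : List Term → List Term → Set where
  here  : ∀ {t t' l} → t ⟶ t' → OneStep (t ∷ l) (t' ∷ l)
  there : ∀ {x l l'} → OneStep l l' → OneStep (x ∷ l) (x ∷ l')

OneStep-DMStep : ∀ {l l'} → OneStep l l' → DMStep l' l
OneStep-DMStep (here {t} {t'} {l} s) = t , l , t' ∷ [] , ↭-refl , ↭-refl , ([ inj₁ s ] ∷ [])
OneStep-DMStep (there r)             = DMStep-∷ (OneStep-DMStep r)

OneStep-sn : ∀ {l l'} → OneStep l l' → All SN⟶ l → All SN⟶ l'
OneStep-sn (here s)  (acc h ∷ sns) = h s ∷ sns
OneStep-sn (there r) (sn ∷ sns)    = sn ∷ OneStep-sn r sns

OneStep-++ : ∀ ts₂ {a b} ts₁ → a ⟶ b → OneStep (ts₂ ++ a ∷ ts₁) (ts₂ ++ b ∷ ts₁)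
OneStep-++ []        ts₁ s = here s
OneStep-++ (x ∷ ts₂) ts₁ s = there (OneStep-++ ts₂ ts₁ s)

SpineStep : ℕ → List Term → Term → Set
SpineStep x ts X =
  (Σ (List Term) λ ts' → (X ≡ apps (var x) ts') × OneStep ts ts') ⊎
  (Σ (List Term) λ ts₁ → Σ (List Term) λ ts₂ → Σ Term λ Q → Σ Term λ P →
     (ts ≡ ts₂ ++ app (lam Q) P ∷ ts₁) × (X ≡ apps (app (lam (app (shift (apps (var x) ts₁)) Q)) P) ts₂))

SpineStep-app : ∀ x t ts {X} → SpineStep x ts X → SpineStep x (t ∷ ts) (app X t)
SpineStep-app x t ts (inj₁ (ts' , refl , r)) = inj₁ (t ∷ ts' , refl , there r)
SpineStep-app x t ts (inj₂ (ts₁ , ts₂ , Q , P , e , refl)) =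
  inj₂ (ts₁ , t ∷ ts₂ , Q , P , cong (t ∷_) e , refl)

-- The spine is unrolled to depth three, so that no β-, δ- or γ-redex can
-- be formed with the variable head.
spine-step : ∀ x ts {X} → apps (var x) ts ⟶ X → SpineStep x ts X
spine-step x [] ()
spine-step x (t ∷ [])              (ξappl ())
spine-step x (t ∷ [])              (ξappr s) = inj₁ (_ ∷ [] , refl , here s)
spine-step x (app (lam Q) P ∷ [])  assoc     = inj₂ ([] , [] , Q , P , refl , refl)
spine-step x (t ∷ t₁ ∷ [])         (ξappl s) = SpineStep-app x t (t₁ ∷ []) (spine-step x (t₁ ∷ []) s)
spine-step x (t ∷ t₁ ∷ [])         (ξappr s) = inj₁ (_ ∷ _ , refl , here s)
spine-step x (app (lam Q) P ∷ t₁ ∷ []) assoc = inj₂ (_ , [] , Q , P , refl , refl)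
spine-step x (t ∷ t₁ ∷ t₂ ∷ ts)    (ξappl s) =
  SpineStep-app x t (t₁ ∷ t₂ ∷ ts) (spine-step x (t₁ ∷ t₂ ∷ ts) s)
spine-step x (t ∷ t₁ ∷ t₂ ∷ ts)    (ξappr s) = inj₁ (_ ∷ _ , refl , here s)
spine-step x (app (lam Q) P ∷ t₁ ∷ t₂ ∷ ts) assoc = inj₂ (_ , [] , Q , P , refl , refl)

-- A variable applied to strongly normalising arguments is strongly
-- normalising, by induction on the multiset of its arguments; an assoc-step
-- yields a redex whose contractum is the spine with one argument reduced.
sn-var-spine-acc : ∀ x ts → Acc DM⁺ ts → All SN⟶ ts → SN⟶ (apps (var x) ts)
sn-var-spine-acc x ts (acc h) sns = acc λ s → next (spine-step x ts s)
  where
  next : ∀ {X} → SpineStep x ts X → SN⟶ X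
  next (inj₁ (ts' , refl , r)) = sn-var-spine-acc x ts' (h [ OneStep-DMStep r ]) (OneStep-sn r sns)
  next (inj₂ (ts₁ , ts₂ , Q , P , refl , refl)) =
    sn-expand (app (shift (apps (var x) ts₁)) Q) P ts₂ (≡.subst SN⟶ contractum sn-reduced) sn-P
    where
    r = OneStep-++ ts₂ ts₁ β
    sn-reduced : SN⟶ (apps (var x) (ts₂ ++ Q [0:= P ] ∷ ts₁))
    sn-reduced = sn-var-spine-acc x _ (h [ OneStep-DMStep r ]) (OneStep-sn r sns)
    contractum : apps (var x) (ts₂ ++ Q [0:= P ] ∷ ts₁) ≡
                 apps ((app (shift (apps (var x) ts₁)) Q) [0:= P ]) ts₂
    contractum = trans (apps-++ (var x) ts₂ _)
                       (cong (λ u → apps (app u (Q [0:= P ])) ts₂) (sym (subst-single-shift P _)))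
    sn-P : SN⟶ P
    sn-P with ++⁻ʳ ts₂ sns
    ... | sn-redex ∷ _ = Full.sn-⊳ sn-redex sub-r

sn-var-spine : ∀ x ts → All SN⟶ ts → SN⟶ (apps (var x) ts)
sn-var-spine x ts sns = sn-var-spine-acc x ts (acc-DM⁺ ts (All.map Full.acc-≺⁺ sns)) sns

data Shape : Term → Set where
  abstraction : ∀ M → Shape (lam M)
  var-spine   : ∀ x ts → Shape (apps (var x) ts)
  redex-spine : ∀ M N ts → Shape (apps (app (lam M) N) ts)

shape : ∀ t → Shape t
shape (var x) = var-spine x []
shape (lam M) = abstraction M
shape (app f a) with shape f
... | abstraction M      = redex-spine M a []
... | var-spine x ts     = var-spine x (a ∷ ts)
... | redex-spine M N ts = redex-spine M N (a ∷ ts)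

args-below : ∀ {P : Term → Set} F ts → (∀ {u} → u Beta.<⁺ apps F ts → P u) → All P ts
args-below F []       below = []
args-below F (t ∷ ts) below =
  below (Beta.<⁺-sub sub-r) ∷ args-below F ts (λ p → below (p Plus.++ Beta.<⁺-sub sub-l))

head-below : ∀ {P : Term → Set} F ts → (∀ {u} → u Beta.<⁺ apps F ts → P u) →
             ∀ {u} → u Beta.<⁺ F → P u
head-below F []       below p = below p
head-below F (t ∷ ts) below p = head-below F ts (λ q → below (q Plus.++ Beta.<⁺-sub sub-l)) p

apps-β : ∀ {F F'} ts → F →β F' → apps F ts →β apps F' ts
apps-β []       s = s
apps-β (t ∷ ts) s = ξappl (apps-β ts s)

sn-from-β : ∀ t → Acc Beta._<⁺_ t → SN⟶ t
sn-from-β t (acc h) = by-shape (shape t) (λ p → sn-from-β _ (h p))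
  where
  by-shape : ∀ {t} → Shape t → (∀ {u} → u Beta.<⁺ t → SN⟶ u) → SN⟶ t
  by-shape (abstraction M)      ih = sn-lam (ih (Beta.<⁺-sub sub-lam))
  by-shape (var-spine x ts)     ih = sn-var-spine x ts (args-below (var x) ts ih)
  by-shape (redex-spine M N ts) ih =
    sn-expand M N ts (ih [ inj₁ (apps-β ts β) ]) (head-below (app (lam M) N) ts ih (Beta.<⁺-sub sub-r))

theorem3p1 : (t : Term) → SN _→β_ t → SN _→βδγa_ t
theorem3p1 t sn = sn-from-β t (Beta.acc-≺⁺ sn)
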